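{- Let $\mathcal{C}$ be a category with coproducts $+$ and let $X\in\mathcal{C}$ be an arbitrary object. (i) If these coproducts satisfy requirements (i) and (ii) of the coproduct assumption below, then the predicates $\mathrm{Pred}(X)$ on $X$ form an effect algebra. (ii) If $\mathcal{C}$ is a dagger additive category which is zerosumfree, then the positive predicates $\mathrm{pPred}(X)$ on $X$ also form an effect algebra.
   Context: A predicate on an object $X$ of a category with coproducts is a map $p\colon X\to X+X$ with $\nabla\circ p=\mathrm{id}_X$, where $\nabla=[\mathrm{id},\mathrm{id}]$; $\mathrm{Pred}(X)$ is the set of these. Truth is $1=\kappa_1$, falsity $0=\kappa_2$, orthocomplement $p^\perp=[\kappa_2,\kappa_1]\circ p$. Two predicates $p,q$ are orthogonal if there is a bound $b\colon X\to (X+X)+X$ with $[\mathrm{id},\kappa_2]\circ b=p$ and $[[\kappa_2,\kappa_1],\kappa_2]\circ b=q$; then their partial sum is $p\boxplus q=(\nabla+\mathrm{id})\circ b$ (for positive predicates the bound is required to be a triple of positive maps). Coproduct assumption: (i) the squares (E) $(f+\mathrm{id})\circ(\mathrm{id}+g)$ on $A+X\to B+Y$, (K) $\kappa_1\circ f=(f+\mathrm{id})\circ\kappa_1$ for $X\to Y+A$, and (K+) $\kappa_1\circ f=(f+g)\circ\kappa_1$ for $X\to Y+B$ are pullbacks; (ii) the two maps $[\mathrm{id},\kappa_2],[[\kappa_2,\kappa_1],\kappa_2]\colon (X+X)+X\rightrightarrows X+X$ are jointly monic. In a dagger biproduct category a predicate $p\colon X\to X\oplus X$ is positive if both $\pi_1\circ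 p$ and $\pi_2\circ p$ are positive maps (of the form $g^\dagger\circ g$); $\mathrm{pPred}(X)$ is the set of positive predicates. Zerosumfree means $f+g=0\Rightarrow f=g=0$ for positive $f,g$; dagger additive means a dagger biproduct category with additive inverses in homsets. An effect algebra is a partial commutative monoid $(E,0,\boxplus)$ with an orthocomplement $x^\perp$ that is the unique element with $x\boxplus x^\perp=1$ (where $1=0^\perp$), and such that $x\perp 1$ implies $x=0$. Here $\boxplus$ denotes the partial sum operation. -}

module Defs where

open import Level using (Level; _⊔_; suc)
open import Relation.Binary using (Rel; IsEquivalence)
open import Data.Product using (Σ; Σ-syntax; _×_; _,_; proj₁)

record Category (o ℓ e : Level) : Set (suc (o ⊔ ℓ ⊔ e)) where
  infixr 9 _∘_
  infix  4 _≈_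
  infix  5 _⇒_
  field
    Obj   : Set o
    _⇒_   : Obj → Obj → Set ℓ
    _≈_   : ∀ {A B} → Rel (A ⇒ B) e
    id    : ∀ {A} → A ⇒ A
    _∘_   : ∀ {A B C} → B ⇒ C → A ⇒ B → A ⇒ C
    equiv : ∀ {A B} → IsEquivalence (_≈_ {A} {B})
    ∘-resp-≈ : ∀ {A B C} {f h : B ⇒ C} {g i : A ⇒ B} →
               f ≈ h → g ≈ i → f ∘ g ≈ h ∘ i
    assoc : ∀ {A B C D} {f : A ⇒ B} {g : B ⇒ C} {h : C ⇒ D} →
            (h ∘ g) ∘ f ≈ h ∘ (g ∘ f)
    identityˡ : ∀ {A B} {f : A ⇒ B} → id ∘ f ≈ f
    identityʳ : ∀ {A B} {f : A ⇒ B} → f ∘ id ≈ f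

record CoproductData {o ℓ e} (C : Category o ℓ e) : Set (o ⊔ ℓ) where
  open Category C
  infixr 6 _+_
  field
    _+_  : Obj → Obj → Obj
    κ₁   : ∀ {A B} → A ⇒ A + B
    κ₂   : ∀ {A B} → B ⇒ A + B
    [_,_] : ∀ {A B Z} → A ⇒ Z → B ⇒ Z → A + B ⇒ Z

  infixr 6 _+₁_
  _+₁_ : ∀ {A B A' B'} → A ⇒ A' → B ⇒ B' → A + B ⇒ A' + B'
  f +₁ g = [ κ₁ ∘ f , κ₂ ∘ g ]

  ∇ : ∀ {A} → A + A ⇒ A
  ∇ = [ id , id ]

  swap : ∀ {A} → A + A ⇒ A + A
  swap = [ κ₂ , κ₁ ]

  IsPred : ∀ {X} → X ⇒ X + X → Set e
  IsPred p = ∇ ∘ p ≈ id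

  truth : ∀ {X} → X ⇒ X + X
  truth = κ₁

  falsity : ∀ {X} → X ⇒ X + X
  falsity = κ₂

  _ᗮ : ∀ {X} → X ⇒ X + X → X ⇒ X + X
  p ᗮ = swap ∘ p

  IsBound : ∀ {X} → (X ⇒ X + X) → (X ⇒ X + X) → ((X ⇒ (X + X) + X)) → Set e
  IsBound p q b = ([ id , κ₂ ] ∘ b ≈ p) × ([ swap , κ₂ ] ∘ b ≈ q)

  Orth : ∀ {X} → (X ⇒ X + X) → (X ⇒ X + X) → Set (ℓ ⊔ e)
  Orth {X} p q = Σ[ b ∈ X ⇒ (X + X) + X ] IsBound p q b

  ⊞ : ∀ {X} {p q : X ⇒ X + X} → Orth p q → X ⇒ X + X
  ⊞ o = (∇ +₁ id) ∘ proj₁ o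

record BinaryCoproducts {o ℓ e} (C : Category o ℓ e) : Set (o ⊔ ℓ ⊔ e) where
  open Category C
  field
    raw : CoproductData C
  open CoproductData raw
  field
    inject₁ : ∀ {A B Z} {f : A ⇒ Z} {g : B ⇒ Z} → [ f , g ] ∘ κ₁ ≈ f
    inject₂ : ∀ {A B Z} {f : A ⇒ Z} {g : B ⇒ Z} → [ f , g ] ∘ κ₂ ≈ g
    unique  : ∀ {A B Z} {f : A ⇒ Z} {g : B ⇒ Z} {h : A + B ⇒ Z} →
              h ∘ κ₁ ≈ f → h ∘ κ₂ ≈ g → [ f , g ] ≈ h

module _ {o ℓ e} (C : Category o ℓ e) where
  open Category C

  record IsPullback {P A B D : Obj} (p₁ : P ⇒ A) (p₂ : P ⇒ B)
                    (f : A ⇒ D) (g : B ⇒ D) : Set (o ⊔ ℓ ⊔ e) where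
    field
      commute   : f ∘ p₁ ≈ g ∘ p₂
      universal : ∀ {Z} (u : Z ⇒ A) (v : Z ⇒ B) → f ∘ u ≈ g ∘ v →
                  Σ[ w ∈ Z ⇒ P ] ((p₁ ∘ w ≈ u) × (p₂ ∘ w ≈ v) ×
                     (∀ (w' : Z ⇒ P) → p₁ ∘ w' ≈ u → p₂ ∘ w' ≈ v → w' ≈ w))

module _ {o ℓ e} (C : Category o ℓ e) (cp : BinaryCoproducts C) where
  open Category C
  open BinaryCoproducts cp
  open CoproductData raw

  record CoproductAssumption : Set (o ⊔ ℓ ⊔ e) where
    field
      pullback-E : ∀ {A B X Y} (f : A ⇒ B) (g : X ⇒ Y) →
        IsPullback C (id +₁ g) (f +₁ id) (f +₁ id) (id +₁ g)
      pullback-K : ∀ {X Y A} (f : X ⇒ Y + A) →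
        IsPullback C (κ₁ {X} {A}) f (f +₁ id) κ₁
      pullback-K+ : ∀ {X Y B A A'} (f : X ⇒ Y + B) (g : A ⇒ A') →
        IsPullback C (κ₁ {X} {A}) f (f +₁ g) κ₁
      -- (ii): [id,κ₂], [[κ₂,κ₁],κ₂] : (X+X)+X ⇉ X+X are jointly monic
      jointly-monic : ∀ {X Z} (u v : Z ⇒ (X + X) + X) →
        [ id , κ₂ ] ∘ u ≈ [ id , κ₂ ] ∘ v →
        [ swap , κ₂ ] ∘ u ≈ [ swap , κ₂ ] ∘ v → u ≈ v

-- Orthogonality is
-- proof-relevant: O x y is the type of witnesses (bounds) of x ⊥ y and
-- the sum is computed from a witness; sum-cong says it is independent of
-- the witness.

record IsEffectAlgebraOn {a e p b : Level} (A : Set a) (_≈_ : Rel A e)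
         (P : A → Set p) (O : A → A → Set b)
         (sum : ∀ {x y} → O x y → A) (zero : A) (orth : A → A)
         : Set (a ⊔ e ⊔ p ⊔ b) where
  one : A
  one = orth zero
  field
    isEquivalence : IsEquivalence _≈_
    P-zero : P zero
    P-orth : ∀ {x} → P x → P (orth x)
    P-sum  : ∀ {x y} → P x → P y → (o : O x y) → P (sum o)
    O-resp   : ∀ {x x' y y'} → P x → P x' → P y → P y' →
               x ≈ x' → y ≈ y' → O x y → O x' y'
    sum-cong : ∀ {x x' y y'} → P x → P x' → P y → P y' →
               x ≈ x' → y ≈ y' → (o : O x y) (o' : O x' y') → sum o ≈ sum o'
    orth-cong : ∀ {x y} → P x → P y → x ≈ y → orth x ≈ orth y
    comm  : ∀ {x y} → P x → P y → (o : O x y) →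
            Σ[ o' ∈ O y x ] (sum o' ≈ sum o)
    assoc : ∀ {x y z} → P x → P y → P z → (o : O x y) (o' : O (sum o) z) →
            Σ[ o₁ ∈ O y z ] Σ[ o₂ ∈ O x (sum o₁) ] (sum o₂ ≈ sum o')
    unit  : ∀ {x} → P x → Σ[ o ∈ O x zero ] (sum o ≈ x)
    orth-sum    : ∀ {x} → P x → Σ[ o ∈ O x (orth x) ] (sum o ≈ one)
    orth-unique : ∀ {x y} → P x → P y → (o : O x y) → sum o ≈ one → y ≈ orth x
    zero-one : ∀ {x} → P x → O x one → x ≈ zero

module _ {o ℓ e} (C : Category o ℓ e) (cd : CoproductData C) where
  open Category C
  open CoproductData cd

  PredIsEffectAlgebra : Obj → Set (ℓ ⊔ e)
  PredIsEffectAlgebra X =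
    IsEffectAlgebraOn (X ⇒ X + X) _≈_ IsPred Orth ⊞ falsity _ᗮ

record DaggerAdditive {o ℓ e} (C : Category o ℓ e) : Set (o ⊔ ℓ ⊔ e) where
  open Category C
  infixl 6 _⊹_
  infixr 6 _⊕_
  field
    _†       : ∀ {A B} → A ⇒ B → B ⇒ A
    †-cong   : ∀ {A B} {f g : A ⇒ B} → f ≈ g → f † ≈ g †
    †-invol  : ∀ {A B} {f : A ⇒ B} → (f †) † ≈ f
    †-id     : ∀ {A} → (id {A}) † ≈ id
    †-∘      : ∀ {A B D} {f : A ⇒ B} {g : B ⇒ D} → (g ∘ f) † ≈ f † ∘ g †
    0m   : ∀ {A B} → A ⇒ B
    _⊹_  : ∀ {A B} → A ⇒ B → A ⇒ B → A ⇒ B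
    neg  : ∀ {A B} → A ⇒ B → A ⇒ B
    ⊹-cong  : ∀ {A B} {f f' g g' : A ⇒ B} → f ≈ f' → g ≈ g' → f ⊹ g ≈ f' ⊹ g'
    ⊹-assoc : ∀ {A B} {f g h : A ⇒ B} → (f ⊹ g) ⊹ h ≈ f ⊹ (g ⊹ h)
    ⊹-comm  : ∀ {A B} {f g : A ⇒ B} → f ⊹ g ≈ g ⊹ f
    ⊹-unit  : ∀ {A B} {f : A ⇒ B} → f ⊹ 0m ≈ f
    ⊹-inv   : ∀ {A B} {f : A ⇒ B} → f ⊹ neg f ≈ 0m
    neg-cong : ∀ {A B} {f g : A ⇒ B} → f ≈ g → neg f ≈ neg g
    ∘-distribˡ : ∀ {A B D} {h : B ⇒ D} {f g : A ⇒ B} → h ∘ (f ⊹ g) ≈ h ∘ f ⊹ h ∘ g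
    ∘-distribʳ : ∀ {A B D} {h : A ⇒ B} {f g : B ⇒ D} → (f ⊹ g) ∘ h ≈ f ∘ h ⊹ g ∘ h
    ∘-zeroˡ : ∀ {A B D} {f : A ⇒ B} → (0m {B} {D}) ∘ f ≈ 0m
    ∘-zeroʳ : ∀ {A B D} {f : B ⇒ D} → f ∘ (0m {A} {B}) ≈ 0m
    †-⊹     : ∀ {A B} {f g : A ⇒ B} → (f ⊹ g) † ≈ f † ⊹ g †
    𝟘      : Obj
    𝟘-zero : id {𝟘} ≈ 0m
    _⊕_ : Obj → Obj → Obj
    ι₁  : ∀ {A B} → A ⇒ A ⊕ B
    ι₂  : ∀ {A B} → B ⇒ A ⊕ B
    π₁  : ∀ {A B} → A ⊕ B ⇒ A
    π₂  : ∀ {A B} → A ⊕ B ⇒ B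
    π₁ι₁ : ∀ {A B} → π₁ ∘ ι₁ {A} {B} ≈ id
    π₂ι₂ : ∀ {A B} → π₂ ∘ ι₂ {A} {B} ≈ id
    π₁ι₂ : ∀ {A B} → π₁ ∘ ι₂ {A} {B} ≈ 0m
    π₂ι₁ : ∀ {A B} → π₂ ∘ ι₁ {A} {B} ≈ 0m
    ιπ   : ∀ {A B} → ι₁ ∘ π₁ ⊹ ι₂ ∘ π₂ ≈ id {A ⊕ B}
    ι₁-dagger : ∀ {A B} → ι₁ {A} {B} ≈ π₁ †
    ι₂-dagger : ∀ {A B} → ι₂ {A} {B} ≈ π₂ †

  coproducts : CoproductData C
  coproducts = record
    { _+_ = _⊕_ ; κ₁ = ι₁ ; κ₂ = ι₂ ; [_,_] = λ f g → f ∘ π₁ ⊹ g ∘ π₂ }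

  Positive : ∀ {A} → A ⇒ A → Set (o ⊔ ℓ ⊔ e)
  Positive {A} f = Σ[ B ∈ Obj ] Σ[ g ∈ A ⇒ B ] (f ≈ g † ∘ g)

  Zerosumfree : Set (o ⊔ ℓ ⊔ e)
  Zerosumfree = ∀ {A} (f g : A ⇒ A) → Positive f → Positive g →
                f ⊹ g ≈ 0m → (f ≈ 0m) × (g ≈ 0m)

  open CoproductData coproducts

  IsPosPred : ∀ {X} → X ⇒ X ⊕ X → Set (o ⊔ ℓ ⊔ e)
  IsPosPred p = IsPred p × Positive (π₁ ∘ p) × Positive (π₂ ∘ p)

  PosOrth : ∀ {X} → (X ⇒ X ⊕ X) → (X ⇒ X ⊕ X) → Set (o ⊔ ℓ ⊔ e)
  PosOrth {X} p q = Σ[ b ∈ X ⇒ (X ⊕ X) ⊕ X ]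
    (IsBound p q b × Positive (π₁ ∘ π₁ ∘ b) × Positive (π₂ ∘ π₁ ∘ b)
                   × Positive (π₂ ∘ b))

  pos⊞ : ∀ {X} {p q : X ⇒ X ⊕ X} → PosOrth p q → X ⇒ X ⊕ X
  pos⊞ o = (∇ +₁ id) ∘ proj₁ o

  PosPredIsEffectAlgebra : Obj → Set (o ⊔ ℓ ⊔ e)
  PosPredIsEffectAlgebra X =
    IsEffectAlgebraOn (X ⇒ X ⊕ X) _≈_ IsPosPred PosOrth pos⊞ falsity _ᗮ

-- (i) A bound b : X → (X+X)+X of (p, q) splits X into a part of p, a part
-- of q and a rest, and p, q, p ⊞ q are read off by bound₁, bound₂, bound⊞.
-- Each law is witnessed by a new bound that regroups these summands; the
-- required equalities of maps out of iterated sums are checked summand by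
-- summand (Acts₃, Acts₄).  Joint monicity makes bounds unique, so ⊞ is well
-- defined; pullback (E) refines two bounds into a fourfold splitting
-- (associativity), and pullbacks (K), (K+) show that a bound with sum 1, resp.
-- a bound of (1, q), factors through κ₁ (uniqueness of ᗮ, zero-one law).
-- (ii) Over biproducts a bound is given by its parts (a, c, r): it bounds
-- (p, q) iff p = (a, c ⊹ r) and q = (c, a ⊹ r), and then p ⊞ q = (a ⊹ c, r).
-- The laws become identities in the abelian group of maps X → X; positive
-- maps are closed under ⊹, and zerosumfreeness gives the zero-one law.
module Submission where

open import Defs
open import Level using (Level)
open import Data.Product using (_×_; _,_; proj₁; proj₂; Σ-syntax)
open import Relation.Binary using (IsEquivalence; Setoid)
import Relation.Binary.Reasoning.Setoid as SetoidReasoning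

module HomReasoning {o ℓ e} (C : Category o ℓ e) where
  open Category C

  hom-setoid : Obj → Obj → Setoid ℓ e
  hom-setoid A B = record { Carrier = A ⇒ B ; _≈_ = _≈_ ; isEquivalence = equiv }

  module _ {A B : Obj} where
    open IsEquivalence (equiv {A} {B}) public
      using () renaming (refl to ≈-refl; sym to ≈-sym; trans to ≈-trans)
    open SetoidReasoning (hom-setoid A B) public

  infixr 4 refl⟩∘⟨_
  infixl 5 _⟩∘⟨refl

  refl⟩∘⟨_ : ∀ {A B D} {f : B ⇒ D} {g g' : A ⇒ B} → g ≈ g' → f ∘ g ≈ f ∘ g'
  refl⟩∘⟨ p = ∘-resp-≈ ≈-refl p

  _⟩∘⟨refl : ∀ {A B D} {f f' : B ⇒ D} {g : A ⇒ B} → f ≈ f' → f ∘ g ≈ f' ∘ g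
  p ⟩∘⟨refl = ∘-resp-≈ p ≈-refl

  pullˡ : ∀ {A B D E} {h : D ⇒ E} {g : B ⇒ D} {f : A ⇒ B} {k : B ⇒ E} →
          h ∘ g ≈ k → h ∘ (g ∘ f) ≈ k ∘ f
  pullˡ p = ≈-trans (≈-sym assoc) (p ⟩∘⟨refl)

  pullʳ : ∀ {A B D E} {h : D ⇒ E} {g : B ⇒ D} {f : A ⇒ B} {k : A ⇒ D} →
          g ∘ f ≈ k → (h ∘ g) ∘ f ≈ h ∘ k
  pullʳ p = ≈-trans assoc (refl⟩∘⟨ p)

module _ {o ℓ e} {C : Category o ℓ e} where
  open Category C

  mediator : ∀ {P A B D Z} {p₁ : P ⇒ A} {p₂ : P ⇒ B} {f : A ⇒ D} {g : B ⇒ D} →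
             IsPullback C p₁ p₂ f g → {u : Z ⇒ A} {v : Z ⇒ B} → f ∘ u ≈ g ∘ v →
             Σ[ w ∈ Z ⇒ P ] (p₁ ∘ w ≈ u) × (p₂ ∘ w ≈ v)
  mediator pb {u} {v} commutes with IsPullback.universal pb u v commutes
  ... | w , wu , wv , _ = w , wu , wv

-- A bound b : Y → (Y+Y)+Y splits Y into a part of p, a part of q and a
-- rest.
module BoundMaps {o ℓ e} {C : Category o ℓ e} (cd : CoproductData C) where
  open Category C
  open CoproductData cd

  bound₁ bound₂ bound⊞ : ∀ {Y} → (Y + Y) + Y ⇒ Y + Y
  bound₁ = [ id , κ₂ ]
  bound₂ = [ swap , κ₂ ]
  bound⊞ = ∇ +₁ id

module CoproductCalculus {o ℓ e} {C : Category o ℓ e} (cp : BinaryCoproducts C) where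
  open Category C
  open HomReasoning C
  open BinaryCoproducts cp
  open CoproductData raw

  +-ext : ∀ {A B Z} {h k : A + B ⇒ Z} → h ∘ κ₁ ≈ k ∘ κ₁ → h ∘ κ₂ ≈ k ∘ κ₂ → h ≈ k
  +-ext p q = ≈-trans (≈-sym (unique ≈-refl ≈-refl)) (unique (≈-sym p) (≈-sym q))

  []-cong : ∀ {A B Z} {f f' : A ⇒ Z} {g g' : B ⇒ Z} → f ≈ f' → g ≈ g' → [ f , g ] ≈ [ f' , g' ]
  []-cong p q = ≈-sym (unique (≈-trans inject₁ p) (≈-trans inject₂ q))

  []∘κ₁∘ : ∀ {A B Z W} {f : A ⇒ Z} {g : B ⇒ Z} {h : W ⇒ A} → [ f , g ] ∘ (κ₁ ∘ h) ≈ f ∘ h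
  []∘κ₁∘ = pullˡ inject₁

  []∘κ₂∘ : ∀ {A B Z W} {f : A ⇒ Z} {g : B ⇒ Z} {h : W ⇒ B} → [ f , g ] ∘ (κ₂ ∘ h) ≈ g ∘ h
  []∘κ₂∘ = pullˡ inject₂

  +₁∘κ₁∘ : ∀ {A B A' B' W} {f : A ⇒ A'} {g : B ⇒ B'} {h : W ⇒ A} →
           (f +₁ g) ∘ (κ₁ ∘ h) ≈ κ₁ ∘ (f ∘ h)
  +₁∘κ₁∘ = ≈-trans []∘κ₁∘ assoc

  +₁∘κ₂∘ : ∀ {A B A' B' W} {f : A ⇒ A'} {g : B ⇒ B'} {h : W ⇒ B} →
           (f +₁ g) ∘ (κ₂ ∘ h) ≈ κ₂ ∘ (g ∘ h)
  +₁∘κ₂∘ = ≈-trans []∘κ₂∘ assoc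

  +₁-∘ : ∀ {A B A' B' A'' B''} {f : A' ⇒ A''} {g : B' ⇒ B''} {h : A ⇒ A'} {k : B ⇒ B'} →
         (f +₁ g) ∘ (h +₁ k) ≈ (f ∘ h) +₁ (g ∘ k)
  +₁-∘ = +-ext (≈-trans (pullʳ inject₁) (≈-trans +₁∘κ₁∘ (≈-sym inject₁)))
               (≈-trans (pullʳ inject₂) (≈-trans +₁∘κ₂∘ (≈-sym inject₂)))

  +₁-cong : ∀ {A B A' B'} {f f' : A ⇒ A'} {g g' : B ⇒ B'} → f ≈ f' → g ≈ g' → f +₁ g ≈ f' +₁ g'
  +₁-cong p q = []-cong (refl⟩∘⟨ p) (refl⟩∘⟨ q)

  ∇∘swap : ∀ {A} → ∇ ∘ swap ≈ ∇ {A}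
  ∇∘swap = +-ext (≈-trans (pullʳ inject₁) (≈-trans inject₂ (≈-sym inject₁)))
                 (≈-trans (pullʳ inject₂) (≈-trans inject₁ (≈-sym inject₂)))

  κ₁₁ : ∀ {A B D} → A ⇒ (A + B) + D
  κ₁₁ = κ₁ ∘ κ₁

  κ₁₂ : ∀ {A B D} → B ⇒ (A + B) + D
  κ₁₂ = κ₁ ∘ κ₂

  κ₂₁ : ∀ {A B D} → B ⇒ A + (B + D)
  κ₂₁ = κ₂ ∘ κ₁

  κ₂₂ : ∀ {A B D} → D ⇒ A + (B + D)
  κ₂₂ = κ₂ ∘ κ₂

  ∘-at : ∀ {A B D E} {H : D ⇒ E} {M : B ⇒ D} {κ : A ⇒ B} {l : A ⇒ D} {a : A ⇒ E} →
         M ∘ κ ≈ l → H ∘ l ≈ a → (H ∘ M) ∘ κ ≈ a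
  ∘-at p q = ≈-trans (pullʳ p) q

  record Acts₃ {A B D Z} (M : (A + B) + D ⇒ Z) (a : A ⇒ Z) (b : B ⇒ Z) (c : D ⇒ Z) : Set e where
    constructor acts₃
    field
      at₁ : M ∘ κ₁₁ ≈ a
      at₂ : M ∘ κ₁₂ ≈ b
      at₃ : M ∘ κ₂ ≈ c
  open Acts₃ public

  cotuple₃ : ∀ {A B D Z} {a : A ⇒ Z} {b : B ⇒ Z} {c : D ⇒ Z} → Acts₃ [ [ a , b ] , c ] a b c
  cotuple₃ = acts₃ (≈-trans []∘κ₁∘ inject₁) (≈-trans []∘κ₁∘ inject₂) inject₂

  regroup-at : ∀ {A B D Z} {M N : D ⇒ Z} {f : B ⇒ D} {g : A ⇒ B} {v : A ⇒ Z} →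
               M ∘ (f ∘ g) ≈ v → N ∘ (f ∘ g) ≈ v → (M ∘ f) ∘ g ≈ (N ∘ f) ∘ g
  regroup-at p q = ≈-trans assoc (≈-trans p (≈-trans (≈-sym q) (≈-sym assoc)))

  acts₃-unique : ∀ {A B D Z} {M N : (A + B) + D ⇒ Z} {a b c} →
                 Acts₃ M a b c → Acts₃ N a b c → M ≈ N
  acts₃-unique m n = +-ext (+-ext (regroup-at (at₁ m) (at₁ n)) (regroup-at (at₂ m) (at₂ n)))
                           (≈-trans (at₃ m) (≈-sym (at₃ n)))

  acts₃-∘ : ∀ {A B D Z Z'} {M : (A + B) + D ⇒ Z} {H : Z ⇒ Z'} {l₁ l₂ l₃ a b c} →
            Acts₃ M l₁ l₂ l₃ → H ∘ l₁ ≈ a → H ∘ l₂ ≈ b → H ∘ l₃ ≈ c → Acts₃ (H ∘ M) a b c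
  acts₃-∘ m p q r = acts₃ (∘-at (at₁ m) p) (∘-at (at₂ m) q) (∘-at (at₃ m) r)

  record Acts₄ {A B D E Z} (M : (A + B) + (D + E) ⇒ Z)
               (a : A ⇒ Z) (b : B ⇒ Z) (c : D ⇒ Z) (d : E ⇒ Z) : Set e where
    constructor acts₄
    field
      at₁₁ : M ∘ κ₁₁ ≈ a
      at₁₂ : M ∘ κ₁₂ ≈ b
      at₂₁ : M ∘ κ₂₁ ≈ c
      at₂₂ : M ∘ κ₂₂ ≈ d
  open Acts₄ public

  cotuple₄ : ∀ {A B D E Z} {a : A ⇒ Z} {b : B ⇒ Z} {c : D ⇒ Z} {d : E ⇒ Z} →
             Acts₄ [ [ a , b ] , [ c , d ] ] a b c d
  cotuple₄ = acts₄ (≈-trans []∘κ₁∘ inject₁) (≈-trans []∘κ₁∘ inject₂)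
                   (≈-trans []∘κ₂∘ inject₁) (≈-trans []∘κ₂∘ inject₂)

  acts₄-unique : ∀ {A B D E Z} {M N : (A + B) + (D + E) ⇒ Z} {a b c d} →
                 Acts₄ M a b c d → Acts₄ N a b c d → M ≈ N
  acts₄-unique m n = +-ext (+-ext (regroup-at (at₁₁ m) (at₁₁ n)) (regroup-at (at₁₂ m) (at₁₂ n)))
                           (+-ext (regroup-at (at₂₁ m) (at₂₁ n)) (regroup-at (at₂₂ m) (at₂₂ n)))

  acts₄-∘ : ∀ {A B D E Z Z'} {M : (A + B) + (D + E) ⇒ Z} {H : Z ⇒ Z'} {l₁ l₂ l₃ l₄ a b c d} →
            Acts₄ M l₁ l₂ l₃ l₄ → H ∘ l₁ ≈ a → H ∘ l₂ ≈ b → H ∘ l₃ ≈ c → H ∘ l₄ ≈ d →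
            Acts₄ (H ∘ M) a b c d
  acts₄-∘ m p q r s = acts₄ (∘-at (at₁₁ m) p) (∘-at (at₁₂ m) q) (∘-at (at₂₁ m) r) (∘-at (at₂₂ m) s)

  open BoundMaps raw public

  bound₁-acts : ∀ {Y} → Acts₃ (bound₁ {Y}) κ₁ κ₂ κ₂
  bound₁-acts = acts₃ (≈-trans []∘κ₁∘ identityˡ) (≈-trans []∘κ₁∘ identityˡ) inject₂

  bound₂-acts : ∀ {Y} → Acts₃ (bound₂ {Y}) κ₂ κ₁ κ₂
  bound₂-acts = acts₃ (≈-trans []∘κ₁∘ inject₁) (≈-trans []∘κ₁∘ inject₂) inject₂

  bound⊞-acts : ∀ {Y} → Acts₃ (bound⊞ {Y}) κ₁ κ₁ κ₂
  bound⊞-acts = acts₃ (≈-trans +₁∘κ₁∘ (≈-trans (refl⟩∘⟨ inject₁) identityʳ))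
                      (≈-trans +₁∘κ₁∘ (≈-trans (refl⟩∘⟨ inject₂) identityʳ))
                      (≈-trans inject₂ identityʳ)

module PredicateEffectAlgebra {o ℓ e} (C : Category o ℓ e) (cp : BinaryCoproducts C)
         (ca : CoproductAssumption C cp) (X : Category.Obj C) where
  open Category C
  open HomReasoning C
  open BinaryCoproducts cp
  open CoproductData raw
  open CoproductAssumption ca
  open CoproductCalculus cp

  Pr : Set ℓ
  Pr = X ⇒ X + X

  falsity-pred : IsPred (falsity {X})
  falsity-pred = inject₂

  ᗮ-pred : {p : Pr} → IsPred p → IsPred (p ᗮ)
  ᗮ-pred px = ≈-trans (pullˡ ∇∘swap) px

  -- Folding p ⊞ q back into X folds all three parts, just as for p.
  ∇∘bound⊞ : ∇ ∘ bound⊞ ≈ ∇ ∘ bound₁ {X}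
  ∇∘bound⊞ = acts₃-unique (acts₃-∘ bound⊞-acts inject₁ inject₁ inject₂)
                          (acts₃-∘ bound₁-acts inject₁ inject₂ inject₂)

  ⊞-pred : {p q : Pr} → IsPred p → (o : Orth p q) → IsPred (⊞ o)
  ⊞-pred px (b , bp , _) = ≈-trans (pullˡ ∇∘bound⊞) (≈-trans (pullʳ bp) px)

  -- Orthogonality is invariant under ≈, and by joint monicity (ii) of the
  -- coproduct assumption a bound is determined by the pair it bounds, so
  -- the sum does not depend on the chosen bound.
  orth-resp : {p p' q q' : Pr} → p ≈ p' → q ≈ q' → Orth p q → Orth p' q'
  orth-resp pp qq (b , bp , bq) = b , ≈-trans bp pp , ≈-trans bq qq

  bound-unique : {p p' q q' : Pr} → p ≈ p' → q ≈ q' →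
                 (o : Orth p q) (o' : Orth p' q') → proj₁ o ≈ proj₁ o'
  bound-unique pp qq (b , bp , bq) (b' , bp' , bq') =
    jointly-monic b b' (≈-trans bp (≈-trans pp (≈-sym bp')))
                       (≈-trans bq (≈-trans qq (≈-sym bq')))

  ⊞-cong : {p p' q q' : Pr} → p ≈ p' → q ≈ q' →
           (o : Orth p q) (o' : Orth p' q') → ⊞ o ≈ ⊞ o'
  ⊞-cong pp qq o o' = refl⟩∘⟨ bound-unique pp qq o o'

  -- Commutativity: exchanging the parts of p and q in a bound.
  exchange : (X + X) + X ⇒ (X + X) + X
  exchange = [ [ κ₁₂ , κ₁₁ ] , κ₂ ]

  bound₁∘exchange : bound₁ ∘ exchange ≈ bound₂
  bound₁∘exchange = acts₃-unique
    (acts₃-∘ cotuple₃ (at₂ bound₁-acts) (at₁ bound₁-acts) (at₃ bound₁-acts)) bound₂-acts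

  bound₂∘exchange : bound₂ ∘ exchange ≈ bound₁
  bound₂∘exchange = acts₃-unique
    (acts₃-∘ cotuple₃ (at₂ bound₂-acts) (at₁ bound₂-acts) (at₃ bound₂-acts)) bound₁-acts

  bound⊞∘exchange : bound⊞ ∘ exchange ≈ bound⊞
  bound⊞∘exchange = acts₃-unique
    (acts₃-∘ cotuple₃ (at₂ bound⊞-acts) (at₁ bound⊞-acts) (at₃ bound⊞-acts)) bound⊞-acts

  exchange-orth : {p q : Pr} (o : Orth p q) → Σ[ o' ∈ Orth q p ] (⊞ o' ≈ ⊞ o)
  exchange-orth (b , bp , bq) =
    (exchange ∘ b , ≈-trans (pullˡ bound₁∘exchange) bq , ≈-trans (pullˡ bound₂∘exchange) bp) ,
    pullˡ bound⊞∘exchange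

  -- Unit: p is bounded with 0 by giving q an empty part.
  pad : X + X ⇒ (X + X) + X
  pad = [ κ₁₁ , κ₂ ]

  bound₁∘pad : bound₁ ∘ pad ≈ id
  bound₁∘pad = +-ext (≈-trans (∘-at inject₁ (at₁ bound₁-acts)) (≈-sym identityˡ))
                     (≈-trans (∘-at inject₂ (at₃ bound₁-acts)) (≈-sym identityˡ))

  bound₂∘pad : bound₂ ∘ pad ≈ κ₂ ∘ ∇
  bound₂∘pad = +-ext
    (≈-trans (∘-at inject₁ (at₁ bound₂-acts)) (≈-sym (≈-trans (pullʳ inject₁) identityʳ)))
    (≈-trans (∘-at inject₂ (at₃ bound₂-acts)) (≈-sym (≈-trans (pullʳ inject₂) identityʳ)))

  bound⊞∘pad : bound⊞ ∘ pad ≈ id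
  bound⊞∘pad = +-ext (≈-trans (∘-at inject₁ (at₁ bound⊞-acts)) (≈-sym identityˡ))
                     (≈-trans (∘-at inject₂ (at₃ bound⊞-acts)) (≈-sym identityˡ))

  pad-orth : {p : Pr} → IsPred p → Σ[ o ∈ Orth p falsity ] (⊞ o ≈ p)
  pad-orth {p} px =
    (pad ∘ p , ≈-trans (pullˡ bound₁∘pad) identityˡ
             , ≈-trans (pullˡ bound₂∘pad) (≈-trans (pullʳ px) identityʳ)) ,
    ≈-trans (pullˡ bound⊞∘pad) identityˡ

  -- Orthosupplement: κ₁ ∘ p bounds p and pᗮ, with sum 1.
  ᗮ-orth : {p : Pr} → IsPred p → Σ[ o ∈ Orth p (p ᗮ) ] (⊞ o ≈ falsity ᗮ)
  ᗮ-orth {p} px =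
    (κ₁ ∘ p , ≈-trans []∘κ₁∘ identityˡ , []∘κ₁∘) ,
    ≈-trans +₁∘κ₁∘ (≈-trans (refl⟩∘⟨ px) (≈-trans identityʳ (≈-sym inject₂)))

  -- If p ⊞ q = 1 then the image of the
  -- bound under (κ₁ ∘ ∇) + id lies in the first summand, so by pullback (K)
  -- the bound is κ₁ ∘ w; reading off p and q from it gives w = p, q = pᗮ.
  ᗮ-unique : {p q : Pr} (o : Orth p q) → ⊞ o ≈ falsity ᗮ → q ≈ p ᗮ
  ᗮ-unique {p} {q} (b , bp , bq) sum-one = begin
    q                    ≈⟨ bq ⟨
    bound₂ ∘ b           ≈⟨ refl⟩∘⟨ κ₁∘w≈b ⟨
    bound₂ ∘ (κ₁ ∘ w)    ≈⟨ []∘κ₁∘ ⟩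
    swap ∘ w             ≈⟨ refl⟩∘⟨ w≈p ⟩
    swap ∘ p             ∎
    where
    in-first-summand : ((κ₁ ∘ ∇) +₁ id) ∘ b ≈ κ₁ ∘ κ₁
    in-first-summand = begin
      ((κ₁ ∘ ∇) +₁ id) ∘ b          ≈⟨ factors ⟩∘⟨refl ⟩
      ((κ₁ +₁ id) ∘ bound⊞) ∘ b     ≈⟨ pullʳ sum-one ⟩
      (κ₁ +₁ id) ∘ (swap ∘ κ₂)      ≈⟨ refl⟩∘⟨ inject₂ ⟩
      (κ₁ +₁ id) ∘ κ₁               ≈⟨ inject₁ ⟩
      κ₁ ∘ κ₁                       ∎
      where
      factors : (κ₁ ∘ ∇) +₁ id ≈ (κ₁ +₁ id) ∘ bound⊞
      factors = ≈-sym (≈-trans +₁-∘ (+₁-cong ≈-refl identityˡ))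
    factor : Σ[ w ∈ Pr ] (κ₁ ∘ w ≈ b) × ((κ₁ ∘ ∇) ∘ w ≈ κ₁)
    factor = mediator (pullback-K {X + X} {X} {X} (κ₁ ∘ ∇)) in-first-summand
    w : Pr
    w = proj₁ factor
    κ₁∘w≈b : κ₁ ∘ w ≈ b
    κ₁∘w≈b = proj₁ (proj₂ factor)
    w≈p : w ≈ p
    w≈p = ≈-trans (≈-sym (≈-trans []∘κ₁∘ identityˡ)) (≈-trans (refl⟩∘⟨ κ₁∘w≈b) bp)

  reassoc : (X + X) + X ⇒ X + (X + X)
  reassoc = [ [ κ₁ , κ₂₁ ] , κ₂₂ ]

  reassoc⁻¹ : X + (X + X) ⇒ (X + X) + X
  reassoc⁻¹ = [ κ₁₁ , [ κ₁₂ , κ₂ ] ]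

  reassoc⁻¹∘κ₂₁ : reassoc⁻¹ ∘ κ₂₁ ≈ κ₁₂
  reassoc⁻¹∘κ₂₁ = ≈-trans []∘κ₂∘ inject₁

  reassoc⁻¹∘κ₂₂ : reassoc⁻¹ ∘ κ₂₂ ≈ κ₂
  reassoc⁻¹∘κ₂₂ = ≈-trans []∘κ₂∘ inject₂

  reassoc-inverse : reassoc⁻¹ ∘ reassoc ≈ id
  reassoc-inverse = acts₃-unique (acts₃-∘ cotuple₃ inject₁ reassoc⁻¹∘κ₂₁ reassoc⁻¹∘κ₂₂)
                                 (acts₃ identityˡ identityˡ identityˡ)

  bound₁-via-reassoc : (id +₁ ∇) ∘ reassoc ≈ bound₁
  bound₁-via-reassoc = acts₃-unique
    (acts₃-∘ cotuple₃ (≈-trans inject₁ identityʳ)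
                      (≈-trans +₁∘κ₂∘ (≈-trans (refl⟩∘⟨ inject₁) identityʳ))
                      (≈-trans +₁∘κ₂∘ (≈-trans (refl⟩∘⟨ inject₂) identityʳ)))
    bound₁-acts

  -- Zero-one law, in the form: if q is orthogonal to p = 1 then q = 0.
  -- The reassociated bound lies in the first summand after κ₁ + ∇, so by
  -- pullback (K+) it is κ₁ ∘ w; then q = κ₂ ∘ w, and ∇ ∘ q = id forces w = id.
  orth-to-truth : {p q : Pr} → IsPred q → Orth p q → p ≈ truth → q ≈ falsity
  orth-to-truth {p} {q} qx (b , bp , bq) p≈1 = begin
    q         ≈⟨ q≈κ₂∘w ⟩
    κ₂ ∘ w    ≈⟨ refl⟩∘⟨ w≈id ⟩
    κ₂ ∘ id   ≈⟨ identityʳ ⟩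
    κ₂        ∎
    where
    in-first-summand : (κ₁ +₁ ∇) ∘ (reassoc ∘ b) ≈ κ₁ ∘ κ₁
    in-first-summand = begin
      (κ₁ +₁ ∇) ∘ (reassoc ∘ b)                 ≈⟨ factors ⟩∘⟨refl ⟩
      ((κ₁ +₁ id) ∘ (id +₁ ∇)) ∘ (reassoc ∘ b)  ≈⟨ pullʳ (pullˡ bound₁-via-reassoc) ⟩
      (κ₁ +₁ id) ∘ (bound₁ ∘ b)                 ≈⟨ refl⟩∘⟨ ≈-trans bp p≈1 ⟩
      (κ₁ +₁ id) ∘ κ₁                           ≈⟨ inject₁ ⟩
      κ₁ ∘ κ₁                                   ∎
      where
      factors : κ₁ +₁ ∇ ≈ (κ₁ +₁ id) ∘ (id +₁ ∇)
      factors = ≈-sym (≈-trans +₁-∘ (+₁-cong identityʳ identityˡ))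
    factor : Σ[ w ∈ X ⇒ X ] (κ₁ ∘ w ≈ reassoc ∘ b) × (κ₁ ∘ w ≈ κ₁)
    factor = mediator (pullback-K+ {X} {X} {X} {X + X} {X} κ₁ ∇) in-first-summand
    w : X ⇒ X
    w = proj₁ factor
    b≈κ₁₁∘w : b ≈ κ₁₁ ∘ w
    b≈κ₁₁∘w = begin
      b                             ≈⟨ identityˡ ⟨
      id ∘ b                        ≈⟨ reassoc-inverse ⟩∘⟨refl ⟨
      (reassoc⁻¹ ∘ reassoc) ∘ b     ≈⟨ pullʳ (≈-sym (proj₁ (proj₂ factor))) ⟩
      reassoc⁻¹ ∘ (κ₁ ∘ w)          ≈⟨ []∘κ₁∘ ⟩
      κ₁₁ ∘ w                       ∎
    q≈κ₂∘w : q ≈ κ₂ ∘ w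
    q≈κ₂∘w = ≈-trans (≈-sym bq) (≈-trans (refl⟩∘⟨ b≈κ₁₁∘w) (pullˡ (at₁ bound₂-acts)))
    w≈id : w ≈ id
    w≈id = ≈-trans (≈-sym (≈-trans []∘κ₂∘ identityˡ)) (≈-trans (refl⟩∘⟨ ≈-sym q≈κ₂∘w) qx)

  orth-one-is-zero : {p : Pr} → IsPred p → Orth p (falsity ᗮ) → p ≈ falsity
  orth-one-is-zero px o = orth-to-truth px (proj₁ (exchange-orth o)) inject₂

  -- Given a bound b of (p, q) and a bound c of (p ⊞ q, r),
  -- pullback (E) refines them into w : X → (X+X)+(X+X) whose four parts
  -- are those of p, q, r and the rest.  The four maps below regroup these
  -- parts into bounds of (p, q), (p ⊞ q, r), (q, r) and (p, q ⊞ r).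
  W : Obj
  W = (X + X) + (X + X)

  bound[p,q] : W ⇒ (X + X) + X
  bound[p,q] = id +₁ ∇

  bound[p⊞q,r] : W ⇒ (X + X) + X
  bound[p⊞q,r] = reassoc⁻¹ ∘ (∇ +₁ id)

  bound[q,r] : W ⇒ (X + X) + X
  bound[q,r] = [ [ κ₂ , κ₁₁ ] , [ κ₁₂ , κ₂ ] ]

  bound[p,q⊞r] : W ⇒ (X + X) + X
  bound[p,q⊞r] = [ [ κ₁₁ , κ₁₂ ] , [ κ₁₂ , κ₂ ] ]

  bound[p,q]-acts : Acts₄ bound[p,q] κ₁₁ κ₁₂ κ₂ κ₂
  bound[p,q]-acts = acts₄ (≈-trans +₁∘κ₁∘ (refl⟩∘⟨ identityˡ))
                          (≈-trans +₁∘κ₁∘ (refl⟩∘⟨ identityˡ))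
                          (≈-trans +₁∘κ₂∘ (≈-trans (refl⟩∘⟨ inject₁) identityʳ))
                          (≈-trans +₁∘κ₂∘ (≈-trans (refl⟩∘⟨ inject₂) identityʳ))

  bound[p⊞q,r]-acts : Acts₄ bound[p⊞q,r] κ₁₁ κ₁₁ κ₁₂ κ₂
  bound[p⊞q,r]-acts = acts₄-∘ merge-acts inject₁ inject₁ reassoc⁻¹∘κ₂₁ reassoc⁻¹∘κ₂₂
    where
    merge-acts : Acts₄ (∇ +₁ id) κ₁ κ₁ κ₂₁ κ₂₂
    merge-acts = acts₄ (≈-trans +₁∘κ₁∘ (≈-trans (refl⟩∘⟨ inject₁) identityʳ))
                       (≈-trans +₁∘κ₁∘ (≈-trans (refl⟩∘⟨ inject₂) identityʳ))
                       (≈-trans +₁∘κ₂∘ (refl⟩∘⟨ identityˡ))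
                       (≈-trans +₁∘κ₂∘ (refl⟩∘⟨ identityˡ))

  [q,r]-first : bound₁ ∘ bound[q,r] ≈ bound₂ ∘ bound[p,q]
  [q,r]-first = acts₄-unique
    (acts₄-∘ cotuple₄ (at₃ bound₁-acts) (at₁ bound₁-acts) (at₂ bound₁-acts) (at₃ bound₁-acts))
    (acts₄-∘ bound[p,q]-acts (at₁ bound₂-acts) (at₂ bound₂-acts) (at₃ bound₂-acts) (at₃ bound₂-acts))

  [q,r]-second : bound₂ ∘ bound[q,r] ≈ bound₂ ∘ bound[p⊞q,r]
  [q,r]-second = acts₄-unique
    (acts₄-∘ cotuple₄ (at₃ bound₂-acts) (at₁ bound₂-acts) (at₂ bound₂-acts) (at₃ bound₂-acts))
    (acts₄-∘ bound[p⊞q,r]-acts (at₁ bound₂-acts) (at₁ bound₂-acts) (at₂ bound₂-acts) (at₃ bound₂-acts))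

  [p,q⊞r]-first : bound₁ ∘ bound[p,q⊞r] ≈ bound₁ ∘ bound[p,q]
  [p,q⊞r]-first = acts₄-unique
    (acts₄-∘ cotuple₄ (at₁ bound₁-acts) (at₂ bound₁-acts) (at₂ bound₁-acts) (at₃ bound₁-acts))
    (acts₄-∘ bound[p,q]-acts (at₁ bound₁-acts) (at₂ bound₁-acts) (at₃ bound₁-acts) (at₃ bound₁-acts))

  [p,q⊞r]-second : bound₂ ∘ bound[p,q⊞r] ≈ bound⊞ ∘ bound[q,r]
  [p,q⊞r]-second = acts₄-unique
    (acts₄-∘ cotuple₄ (at₁ bound₂-acts) (at₂ bound₂-acts) (at₂ bound₂-acts) (at₃ bound₂-acts))
    (acts₄-∘ cotuple₄ (at₃ bound⊞-acts) (at₁ bound⊞-acts) (at₂ bound⊞-acts) (at₃ bound⊞-acts))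

  [p,q⊞r]-sum : bound⊞ ∘ bound[p,q⊞r] ≈ bound⊞ ∘ bound[p⊞q,r]
  [p,q⊞r]-sum = acts₄-unique
    (acts₄-∘ cotuple₄ (at₁ bound⊞-acts) (at₂ bound⊞-acts) (at₂ bound⊞-acts) (at₃ bound⊞-acts))
    (acts₄-∘ bound[p⊞q,r]-acts (at₁ bound⊞-acts) (at₁ bound⊞-acts) (at₂ bound⊞-acts) (at₃ bound⊞-acts))

  ⊞-assoc : {p q r : Pr} (o : Orth p q) (o' : Orth (⊞ o) r) →
            Σ[ o₁ ∈ Orth q r ] Σ[ o₂ ∈ Orth p (⊞ o₁) ] (⊞ o₂ ≈ ⊞ o')
  ⊞-assoc (b , bp , bq) (c , cs , cr) =
    (bound[q,r] ∘ w , ≈-trans (pullˡ [q,r]-first) (≈-trans (pullʳ w-b) bq)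
                    , ≈-trans (pullˡ [q,r]-second) (≈-trans (pullʳ w-c) cr)) ,
    (bound[p,q⊞r] ∘ w , ≈-trans (pullˡ [p,q⊞r]-first) (≈-trans (pullʳ w-b) bp)
                      , ≈-trans (pullˡ [p,q⊞r]-second) assoc) ,
    ≈-trans (pullˡ [p,q⊞r]-sum) (pullʳ w-c)
    where
    compatible : (∇ +₁ id) ∘ b ≈ (id +₁ ∇) ∘ (reassoc ∘ c)
    compatible = ≈-sym (≈-trans (pullˡ bound₁-via-reassoc) cs)
    refinement : Σ[ w ∈ X ⇒ W ] (bound[p,q] ∘ w ≈ b) × ((∇ +₁ id) ∘ w ≈ reassoc ∘ c)
    refinement = mediator (pullback-E {X + X} {X} {X + X} {X} ∇ ∇) compatible
    w : X ⇒ W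
    w = proj₁ refinement
    w-b : bound[p,q] ∘ w ≈ b
    w-b = proj₁ (proj₂ refinement)
    w-c : bound[p⊞q,r] ∘ w ≈ c
    w-c = begin
      (reassoc⁻¹ ∘ (∇ +₁ id)) ∘ w   ≈⟨ pullʳ (proj₂ (proj₂ refinement)) ⟩
      reassoc⁻¹ ∘ (reassoc ∘ c)     ≈⟨ pullˡ reassoc-inverse ⟩
      id ∘ c                        ≈⟨ identityˡ ⟩
      c                             ∎

  pred-effect-algebra : PredIsEffectAlgebra C raw X
  pred-effect-algebra = record
    { isEquivalence = equiv
    ; P-zero        = falsity-pred
    ; P-orth        = ᗮ-pred
    ; P-sum         = λ px _ → ⊞-pred px
    ; O-resp        = λ _ _ _ _ → orth-resp
    ; sum-cong      = λ _ _ _ _ → ⊞-cong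
    ; orth-cong     = λ _ _ → refl⟩∘⟨_
    ; comm          = λ _ _ → exchange-orth
    ; assoc         = λ _ _ _ → ⊞-assoc
    ; unit          = pad-orth
    ; orth-sum      = ᗮ-orth
    ; orth-unique   = λ _ _ → ᗮ-unique
    ; zero-one      = orth-one-is-zero
    }

module BiproductCalculus {o ℓ e} {C : Category o ℓ e} (D : DaggerAdditive C) where
  open Category C
  open HomReasoning C
  open DaggerAdditive D
  open CoproductData coproducts

  infixl 6 _⟩⊹⟨_
  _⟩⊹⟨_ : ∀ {A B} {f f' g g' : A ⇒ B} → f ≈ f' → g ≈ g' → f ⊹ g ≈ f' ⊹ g'
  _⟩⊹⟨_ = ⊹-cong

  ⊹-identityˡ : ∀ {A B} {f : A ⇒ B} → 0m ⊹ f ≈ f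
  ⊹-identityˡ = ≈-trans ⊹-comm ⊹-unit

  ⊹-swapˡ : ∀ {A B} {f g h : A ⇒ B} → f ⊹ (g ⊹ h) ≈ g ⊹ (f ⊹ h)
  ⊹-swapˡ = ≈-trans (≈-sym ⊹-assoc) (≈-trans (⊹-comm ⟩⊹⟨ ≈-refl) ⊹-assoc)

  ⊹-cancelʳ : ∀ {A B} {f g h : A ⇒ B} → f ⊹ h ≈ g ⊹ h → f ≈ g
  ⊹-cancelʳ {f = f} {g} {h} eq = begin
    f                  ≈⟨ ⊹-unit ⟨
    f ⊹ 0m             ≈⟨ ≈-refl ⟩⊹⟨ ⊹-inv ⟨
    f ⊹ (h ⊹ neg h)    ≈⟨ ⊹-assoc ⟨
    (f ⊹ h) ⊹ neg h    ≈⟨ eq ⟩⊹⟨ ≈-refl ⟩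
    (g ⊹ h) ⊹ neg h    ≈⟨ ⊹-assoc ⟩
    g ⊹ (h ⊹ neg h)    ≈⟨ ≈-refl ⟩⊹⟨ ⊹-inv ⟩
    g ⊹ 0m             ≈⟨ ⊹-unit ⟩
    g                  ∎

  ⊹-cancelˡ : ∀ {A B} {f g h : A ⇒ B} → h ⊹ f ≈ h ⊹ g → f ≈ g
  ⊹-cancelˡ eq = ⊹-cancelʳ (≈-trans ⊹-comm (≈-trans eq ⊹-comm))

  π₁∘ι₁∘ : ∀ {A B W} {f : W ⇒ A} → π₁ {A} {B} ∘ (ι₁ ∘ f) ≈ f
  π₁∘ι₁∘ = ≈-trans (pullˡ π₁ι₁) identityˡ

  π₁∘ι₂∘ : ∀ {A B W} {f : W ⇒ B} → π₁ {A} {B} ∘ (ι₂ ∘ f) ≈ 0m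
  π₁∘ι₂∘ = ≈-trans (pullˡ π₁ι₂) ∘-zeroˡ

  π₂∘ι₁∘ : ∀ {A B W} {f : W ⇒ A} → π₂ {A} {B} ∘ (ι₁ ∘ f) ≈ 0m
  π₂∘ι₁∘ = ≈-trans (pullˡ π₂ι₁) ∘-zeroˡ

  π₂∘ι₂∘ : ∀ {A B W} {f : W ⇒ B} → π₂ {A} {B} ∘ (ι₂ ∘ f) ≈ f
  π₂∘ι₂∘ = ≈-trans (pullˡ π₂ι₂) identityˡ

  ⟨_,_⟩ : ∀ {W A B} → W ⇒ A → W ⇒ B → W ⇒ A ⊕ B
  ⟨ a , b ⟩ = ι₁ ∘ a ⊹ ι₂ ∘ b

  Components : ∀ {W A B} → W ⇒ A ⊕ B → W ⇒ A → W ⇒ B → Set e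
  Components v a b = (π₁ ∘ v ≈ a) × (π₂ ∘ v ≈ b)

  ⟨⟩-components : ∀ {W A B} {a : W ⇒ A} {b : W ⇒ B} → Components ⟨ a , b ⟩ a b
  ⟨⟩-components = ≈-trans ∘-distribˡ (≈-trans (π₁∘ι₁∘ ⟩⊹⟨ π₁∘ι₂∘) ⊹-unit)
                , ≈-trans ∘-distribˡ (≈-trans (π₂∘ι₁∘ ⟩⊹⟨ π₂∘ι₂∘) ⊹-identityˡ)

  components-resp : ∀ {W A B} {v v' : W ⇒ A ⊕ B} {a a' b b'} →
                    v ≈ v' → a ≈ a' → b ≈ b' → Components v a b → Components v' a' b'
  components-resp vv aa bb (va , vb) =
    ≈-trans (refl⟩∘⟨ ≈-sym vv) (≈-trans va aa) , ≈-trans (refl⟩∘⟨ ≈-sym vv) (≈-trans vb bb)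

  ⊕-η : ∀ {W A B} {v : W ⇒ A ⊕ B} → v ≈ ⟨ π₁ ∘ v , π₂ ∘ v ⟩
  ⊕-η {v = v} = begin
    v                                ≈⟨ identityˡ ⟨
    id ∘ v                           ≈⟨ ιπ ⟩∘⟨refl ⟨
    (ι₁ ∘ π₁ ⊹ ι₂ ∘ π₂) ∘ v          ≈⟨ ∘-distribʳ ⟩
    (ι₁ ∘ π₁) ∘ v ⊹ (ι₂ ∘ π₂) ∘ v    ≈⟨ assoc ⟩⊹⟨ assoc ⟩
    ⟨ π₁ ∘ v , π₂ ∘ v ⟩              ∎

  components-unique : ∀ {W A B} {v v' : W ⇒ A ⊕ B} {a b} →
                      Components v a b → Components v' a b → v ≈ v'
  components-unique (va , vb) (va' , vb') =
    ≈-trans ⊕-η (≈-trans ((refl⟩∘⟨ ≈-trans va (≈-sym va')) ⟩⊹⟨ (refl⟩∘⟨ ≈-trans vb (≈-sym vb')))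
                         (≈-sym ⊕-η))

  ∘-cotuple : ∀ {A B Z Z' W} {h : Z ⇒ Z'} {f : A ⇒ Z} {g : B ⇒ Z} {u : W ⇒ A ⊕ B} →
              h ∘ ([ f , g ] ∘ u) ≈ (h ∘ f) ∘ (π₁ ∘ u) ⊹ (h ∘ g) ∘ (π₂ ∘ u)
  ∘-cotuple {h = h} {f} {g} {u} = begin
    h ∘ ((f ∘ π₁ ⊹ g ∘ π₂) ∘ u)               ≈⟨ refl⟩∘⟨ ≈-trans ∘-distribʳ (assoc ⟩⊹⟨ assoc) ⟩
    h ∘ (f ∘ (π₁ ∘ u) ⊹ g ∘ (π₂ ∘ u))         ≈⟨ ∘-distribˡ ⟩
    h ∘ (f ∘ (π₁ ∘ u)) ⊹ h ∘ (g ∘ (π₂ ∘ u))   ≈⟨ ≈-sym assoc ⟩⊹⟨ ≈-sym assoc ⟩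
    (h ∘ f) ∘ (π₁ ∘ u) ⊹ (h ∘ g) ∘ (π₂ ∘ u)   ∎

  ∇-components : ∀ {A W} {v : W ⇒ A ⊕ A} → ∇ ∘ v ≈ π₁ ∘ v ⊹ π₂ ∘ v
  ∇-components = ≈-trans ∘-distribʳ (≈-trans assoc identityˡ ⟩⊹⟨ ≈-trans assoc identityˡ)

  π₁∘swap : ∀ {A} → π₁ ∘ swap ≈ π₂ {A} {A}
  π₁∘swap = ≈-trans ∘-distribˡ (≈-trans (π₁∘ι₂∘ ⟩⊹⟨ π₁∘ι₁∘) ⊹-identityˡ)

  π₂∘swap : ∀ {A} → π₂ ∘ swap ≈ π₁ {A} {A}
  π₂∘swap = ≈-trans ∘-distribˡ (≈-trans (π₂∘ι₂∘ ⟩⊹⟨ π₂∘ι₁∘) ⊹-unit)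

  swap-components : ∀ {A W} {v : W ⇒ A ⊕ A} → Components (swap ∘ v) (π₂ ∘ v) (π₁ ∘ v)
  swap-components = pullˡ π₁∘swap , pullˡ π₂∘swap

  positive-resp : ∀ {A} {f f' : A ⇒ A} → f ≈ f' → Positive f → Positive f'
  positive-resp eq (B , g , p) = B , g , ≈-trans (≈-sym eq) p

  positive-zero : ∀ {A} → Positive (0m {A} {A})
  positive-zero {A} = A , 0m , ≈-sym ∘-zeroʳ

  positive-id : ∀ {A} → Positive (id {A})
  positive-id {A} = A , id , ≈-sym (≈-trans identityʳ †-id)

  -- g₁† g₁ ⊹ g₂† g₂ = h† h for h = ⟨ g₁ , g₂ ⟩.
  positive-⊹ : ∀ {A} {f g : A ⇒ A} → Positive f → Positive g → Positive (f ⊹ g)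
  positive-⊹ {A} {f} {g} (B₁ , g₁ , f≈) (B₂ , g₂ , g≈) = B₁ ⊕ B₂ , h , ≈-sym h†h
    where
    h : A ⇒ B₁ ⊕ B₂
    h = ⟨ g₁ , g₂ ⟩
    ι†≈π : ∀ {A B} → (ι₁ {A} {B}) † ≈ π₁ × (ι₂ {A} {B}) † ≈ π₂
    ι†≈π = ≈-trans (†-cong ι₁-dagger) †-invol , ≈-trans (†-cong ι₂-dagger) †-invol
    h† : h † ≈ [ g₁ † , g₂ † ]
    h† = ≈-trans †-⊹ (≈-trans †-∘ (refl⟩∘⟨ proj₁ ι†≈π) ⟩⊹⟨ ≈-trans †-∘ (refl⟩∘⟨ proj₂ ι†≈π))
    h†h : h † ∘ h ≈ f ⊹ g
    h†h = begin
      h † ∘ h                                     ≈⟨ h† ⟩∘⟨refl ⟩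
      [ g₁ † , g₂ † ] ∘ h                         ≈⟨ identityˡ ⟨
      id ∘ ([ g₁ † , g₂ † ] ∘ h)                  ≈⟨ ∘-cotuple ⟩
      (id ∘ g₁ †) ∘ (π₁ ∘ h) ⊹ (id ∘ g₂ †) ∘ (π₂ ∘ h)
        ≈⟨ ∘-resp-≈ identityˡ (proj₁ ⟨⟩-components) ⟩⊹⟨ ∘-resp-≈ identityˡ (proj₂ ⟨⟩-components) ⟩
      g₁ † ∘ g₁ ⊹ g₂ † ∘ g₂                       ≈⟨ f≈ ⟩⊹⟨ g≈ ⟨
      f ⊹ g                                       ∎

-- A bound u is described by its three parts (a, c, r);
-- it bounds (p, q) iff p = (a, c ⊹ r) and q = (c, a ⊹ r) componentwise,
-- and then p ⊞ q = (a ⊹ c, r).  Each law becomes an identity between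
-- components in the abelian group of maps X → X.
module PositivePredicateEffectAlgebra {o ℓ e} (C : Category o ℓ e) (D : DaggerAdditive C)
         (zerosumfree : DaggerAdditive.Zerosumfree D) (X : Category.Obj C) where
  open Category C
  open HomReasoning C
  open DaggerAdditive D
  open CoproductData coproducts
  open BoundMaps coproducts
  open BiproductCalculus D

  Pr : Set ℓ
  Pr = X ⇒ X ⊕ X

  part₁ part₂ rest : ∀ {W} → W ⇒ (X ⊕ X) ⊕ X → W ⇒ X
  part₁ u = π₁ ∘ π₁ ∘ u
  part₂ u = π₂ ∘ π₁ ∘ u
  rest  u = π₂ ∘ u

  triple : X ⇒ X → X ⇒ X → X ⇒ X → X ⇒ (X ⊕ X) ⊕ X
  triple a c r = ⟨ ⟨ a , c ⟩ , r ⟩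

  part₁-triple : ∀ {a c r} → part₁ (triple a c r) ≈ a
  part₁-triple = ≈-trans (refl⟩∘⟨ proj₁ ⟨⟩-components) (proj₁ ⟨⟩-components)

  part₂-triple : ∀ {a c r} → part₂ (triple a c r) ≈ c
  part₂-triple = ≈-trans (refl⟩∘⟨ proj₁ ⟨⟩-components) (proj₂ ⟨⟩-components)

  rest-triple : ∀ {a c r} → rest (triple a c r) ≈ r
  rest-triple = proj₂ ⟨⟩-components

  parts-unique : ∀ {u u' : X ⇒ (X ⊕ X) ⊕ X} →
    part₁ u ≈ part₁ u' → part₂ u ≈ part₂ u' → rest u ≈ rest u' → u ≈ u'
  parts-unique p₁ p₂ r = components-unique (components-unique (p₁ , p₂) (≈-refl , ≈-refl) , r)
                                           (≈-refl , ≈-refl)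

  bound₁-components : ∀ {W} {u : W ⇒ (X ⊕ X) ⊕ X} →
                      Components (bound₁ ∘ u) (part₁ u) (part₂ u ⊹ rest u)
  bound₁-components =
    ≈-trans ∘-cotuple (≈-trans ((identityʳ ⟩∘⟨refl) ⟩⊹⟨ ≈-trans (π₁ι₂ ⟩∘⟨refl) ∘-zeroˡ) ⊹-unit) ,
    ≈-trans ∘-cotuple ((identityʳ ⟩∘⟨refl) ⟩⊹⟨ ≈-trans (π₂ι₂ ⟩∘⟨refl) identityˡ)

  bound₂-components : ∀ {W} {u : W ⇒ (X ⊕ X) ⊕ X} →
                      Components (bound₂ ∘ u) (part₂ u) (part₁ u ⊹ rest u)
  bound₂-components =
    ≈-trans ∘-cotuple (≈-trans ((π₁∘swap ⟩∘⟨refl) ⟩⊹⟨ ≈-trans (π₁ι₂ ⟩∘⟨refl) ∘-zeroˡ) ⊹-unit) ,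
    ≈-trans ∘-cotuple ((π₂∘swap ⟩∘⟨refl) ⟩⊹⟨ ≈-trans (π₂ι₂ ⟩∘⟨refl) identityˡ)

  bound⊞-components : ∀ {W} {u : W ⇒ (X ⊕ X) ⊕ X} →
                      Components (bound⊞ ∘ u) (part₁ u ⊹ part₂ u) (rest u)
  bound⊞-components =
    ≈-trans ∘-cotuple (≈-trans (≈-trans (π₁∘ι₁∘ ⟩∘⟨refl) ∇-components ⟩⊹⟨
                                ≈-trans (π₁∘ι₂∘ ⟩∘⟨refl) ∘-zeroˡ) ⊹-unit) ,
    ≈-trans ∘-cotuple (≈-trans (≈-trans (π₂∘ι₁∘ ⟩∘⟨refl) ∘-zeroˡ ⟩⊹⟨
                                ≈-trans (π₂∘ι₂∘ ⟩∘⟨refl) identityˡ) ⊹-identityˡ)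

  triple-sum : ∀ {a c r} → Components (bound⊞ ∘ triple a c r) (a ⊹ c) r
  triple-sum = components-resp ≈-refl (part₁-triple ⟩⊹⟨ part₂-triple) rest-triple bound⊞-components

  record Splits (p q : Pr) (a c r : X ⇒ X) : Set e where
    field
      π₁p : π₁ ∘ p ≈ a
      π₂p : π₂ ∘ p ≈ c ⊹ r
      π₁q : π₁ ∘ q ≈ c
      π₂q : π₂ ∘ q ≈ a ⊹ r

  bound-splits : ∀ {p q u} → IsBound p q u → Splits p q (part₁ u) (part₂ u) (rest u)
  bound-splits (up , uq) = record
    { π₁p = ≈-trans (refl⟩∘⟨ ≈-sym up) (proj₁ bound₁-components)
    ; π₂p = ≈-trans (refl⟩∘⟨ ≈-sym up) (proj₂ bound₁-components)
    ; π₁q = ≈-trans (refl⟩∘⟨ ≈-sym uq) (proj₁ bound₂-components)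
    ; π₂q = ≈-trans (refl⟩∘⟨ ≈-sym uq) (proj₂ bound₂-components)
    }

  triple-bounds : ∀ {p q a c r} → Splits p q a c r → IsBound p q (triple a c r)
  triple-bounds s =
    components-unique (components-resp ≈-refl part₁-triple (part₂-triple ⟩⊹⟨ rest-triple)
                                       bound₁-components) (π₁p , π₂p) ,
    components-unique (components-resp ≈-refl part₂-triple (part₁-triple ⟩⊹⟨ rest-triple)
                                       bound₂-components) (π₁q , π₂q)
    where open Splits s

  positive-bound : ∀ {p q} (a c r : X ⇒ X) → Positive a → Positive c → Positive r →
                   Splits p q a c r → PosOrth p q
  positive-bound a c r pa pc pr s =
    triple a c r , triple-bounds s , positive-resp (≈-sym part₁-triple) pa
                                   , positive-resp (≈-sym part₂-triple) pc
                                   , positive-resp (≈-sym rest-triple) pr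

  pred-components : ∀ {p : Pr} → IsPred p → π₁ ∘ p ⊹ π₂ ∘ p ≈ id
  pred-components px = ≈-trans (≈-sym ∇-components) px

  pospred-by-components : ∀ {p : Pr} {a b} → Components p a b → a ⊹ b ≈ id →
                          Positive a → Positive b → IsPosPred p
  pospred-by-components (pa , pb) sum posa posb =
    ≈-trans ∇-components (≈-trans (pa ⟩⊹⟨ pb) sum) ,
    positive-resp (≈-sym pa) posa , positive-resp (≈-sym pb) posb

  one-components : Components (falsity ᗮ) (id {X}) 0m
  one-components = components-resp ≈-refl π₂ι₂ π₁ι₂ swap-components

  falsity-pospred : IsPosPred (falsity {X})
  falsity-pospred = pospred-by-components (π₁ι₂ , π₂ι₂) ⊹-identityˡ positive-zero positive-id

  ᗮ-pospred : {p : Pr} → IsPosPred p → IsPosPred (p ᗮ)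
  ᗮ-pospred (px , pos₁ , pos₂) =
    pospred-by-components swap-components (≈-trans ⊹-comm (pred-components px)) pos₂ pos₁

  ⊞-pospred : {p q : Pr} → IsPosPred p → (o : PosOrth p q) → IsPosPred (pos⊞ o)
  ⊞-pospred {p} (px , _) (b , bnd , pa , pc , pr) =
    pospred-by-components bound⊞-components total (positive-⊹ pa pc) pr
    where
    open Splits (bound-splits bnd)
    total : (part₁ b ⊹ part₂ b) ⊹ rest b ≈ id
    total = begin
      (part₁ b ⊹ part₂ b) ⊹ rest b  ≈⟨ ⊹-assoc ⟩
      part₁ b ⊹ (part₂ b ⊹ rest b)  ≈⟨ π₁p ⟩⊹⟨ π₂p ⟨
      π₁ ∘ p ⊹ π₂ ∘ p               ≈⟨ pred-components px ⟩
      id                            ∎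

  -- A bound is determined by the
  -- pair it bounds: two parts are components of p and q, and the rest is
  -- then fixed by cancellation; hence the sum is independent of the bound.
  pos-orth-resp : {p p' q q' : Pr} → p ≈ p' → q ≈ q' → PosOrth p q → PosOrth p' q'
  pos-orth-resp pp qq (b , (bp , bq) , pos) = b , (≈-trans bp pp , ≈-trans bq qq) , pos

  pos-bound-unique : {p p' q q' : Pr} → p ≈ p' → q ≈ q' →
                     (o : PosOrth p q) (o' : PosOrth p' q') → proj₁ o ≈ proj₁ o'
  pos-bound-unique {p} {p'} pp qq (b , bnd , _) (b' , bnd' , _) =
    parts-unique same-part₁ same-part₂ same-rest
    where
    module S  = Splits (bound-splits bnd)
    module S' = Splits (bound-splits bnd')
    same-part₁ : part₁ b ≈ part₁ b'
    same-part₁ = ≈-trans (≈-sym S.π₁p) (≈-trans (refl⟩∘⟨ pp) S'.π₁p)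
    same-part₂ : part₂ b ≈ part₂ b'
    same-part₂ = ≈-trans (≈-sym S.π₁q) (≈-trans (refl⟩∘⟨ qq) S'.π₁q)
    same-rest : rest b ≈ rest b'
    same-rest = ⊹-cancelˡ (begin
      part₂ b ⊹ rest b     ≈⟨ S.π₂p ⟨
      π₂ ∘ p               ≈⟨ refl⟩∘⟨ pp ⟩
      π₂ ∘ p'              ≈⟨ S'.π₂p ⟩
      part₂ b' ⊹ rest b'   ≈⟨ same-part₂ ⟩⊹⟨ ≈-refl ⟨
      part₂ b ⊹ rest b'    ∎)

  pos⊞-cong : {p p' q q' : Pr} → p ≈ p' → q ≈ q' →
              (o : PosOrth p q) (o' : PosOrth p' q') → pos⊞ o ≈ pos⊞ o'
  pos⊞-cong pp qq o o' = refl⟩∘⟨ pos-bound-unique pp qq o o'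

  -- Commutativity: the parts (c, a, r) split (q, p).
  pos⊞-comm : {p q : Pr} (o : PosOrth p q) → Σ[ o' ∈ PosOrth q p ] (pos⊞ o' ≈ pos⊞ o)
  pos⊞-comm (b , bnd , pa , pc , pr) =
    positive-bound (part₂ b) (part₁ b) (rest b) pc pa pr
      (record { π₁p = π₁q ; π₂p = π₂q ; π₁q = π₁p ; π₂q = π₂p }) ,
    components-unique (components-resp ≈-refl ⊹-comm ≈-refl triple-sum) bound⊞-components
    where open Splits (bound-splits bnd)

  -- Unit: the parts (π₁p, 0, π₂p) split (p, 0).
  pos⊞-unit : {p : Pr} → IsPosPred p → Σ[ o ∈ PosOrth p falsity ] (pos⊞ o ≈ p)
  pos⊞-unit {p} (px , pos₁ , pos₂) =
    positive-bound (π₁ ∘ p) 0m (π₂ ∘ p) pos₁ positive-zero pos₂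
      (record { π₁p = ≈-refl ; π₂p = ≈-sym ⊹-identityˡ
              ; π₁q = π₁ι₂   ; π₂q = ≈-trans π₂ι₂ (≈-sym (pred-components px)) }) ,
    components-unique (components-resp ≈-refl ⊹-unit ≈-refl triple-sum) (≈-refl , ≈-refl)

  -- Orthosupplement: the parts (π₁p, π₂p, 0) split (p, pᗮ), with sum 1.
  pos-ᗮ-orth : {p : Pr} → IsPosPred p → Σ[ o ∈ PosOrth p (p ᗮ) ] (pos⊞ o ≈ falsity ᗮ)
  pos-ᗮ-orth {p} (px , pos₁ , pos₂) =
    positive-bound (π₁ ∘ p) (π₂ ∘ p) 0m pos₁ pos₂ positive-zero
      (record { π₁p = ≈-refl ; π₂p = ≈-sym ⊹-unit
              ; π₁q = proj₁ swap-components ; π₂q = ≈-trans (proj₂ swap-components) (≈-sym ⊹-unit) }) ,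
    components-unique (components-resp ≈-refl (pred-components px) ≈-refl triple-sum) one-components

  -- Uniqueness of the orthosupplement: p ⊞ q = 1 forces the rest to vanish,
  -- so q = (c, a) = pᗮ.
  pos-ᗮ-unique : {p q : Pr} (o : PosOrth p q) → pos⊞ o ≈ falsity ᗮ → q ≈ p ᗮ
  pos-ᗮ-unique {p} (b , bnd , _) sum-one =
    components-unique (components-resp ≈-refl q₁ q₂ (π₁q , π₂q)) swap-components
    where
    open Splits (bound-splits bnd)
    rest≈0 : rest b ≈ 0m
    rest≈0 = ≈-trans (≈-sym (proj₂ bound⊞-components))
                     (≈-trans (refl⟩∘⟨ sum-one) (proj₂ one-components))
    q₁ : part₂ b ≈ π₂ ∘ p
    q₁ = ≈-trans (≈-sym ⊹-unit) (≈-trans (≈-refl ⟩⊹⟨ ≈-sym rest≈0) (≈-sym π₂p))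
    q₂ : part₁ b ⊹ rest b ≈ π₁ ∘ p
    q₂ = ≈-trans (≈-refl ⟩⊹⟨ rest≈0) (≈-trans ⊹-unit (≈-sym π₁p))

  -- Zero-one law: if p ⊥ 1 then a ⊹ r = 0 for the positive parts a, r,
  -- so both vanish by zerosumfreeness and p = (0, c) = (0, 1) = 0.
  pos-orth-one-is-zero : {p : Pr} → PosOrth p (falsity ᗮ) → p ≈ falsity
  pos-orth-one-is-zero (b , bnd , pa , pc , pr) =
    components-unique (components-resp ≈-refl p₁ p₂ (π₁p , π₂p)) (π₁ι₂ , π₂ι₂)
    where
    open Splits (bound-splits bnd)
    vanish : (part₁ b ≈ 0m) × (rest b ≈ 0m)
    vanish = zerosumfree (part₁ b) (rest b) pa pr
               (≈-trans (≈-sym π₂q) (proj₂ one-components))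
    p₁ : part₁ b ≈ 0m
    p₁ = proj₁ vanish
    p₂ : part₂ b ⊹ rest b ≈ id
    p₂ = ≈-trans (≈-refl ⟩⊹⟨ proj₂ vanish) (≈-trans ⊹-unit (≈-trans (≈-sym π₁q) (proj₁ one-components)))

  -- If (a₁, c₁, r₁) splits (p, q) and (a₂, c₂, r₂) splits
  -- (p ⊞ q, r), then a₂ = a₁ ⊹ c₁ and c₂ ⊹ r₂ = r₁; the parts
  -- (c₁, c₂, a₁ ⊹ r₂) split (q, r) and (a₁, c₁ ⊹ c₂, r₂) split (p, q ⊞ r).
  pos⊞-assoc : {p q r : Pr} (o : PosOrth p q) (o' : PosOrth (pos⊞ o) r) →
               Σ[ o₁ ∈ PosOrth q r ] Σ[ o₂ ∈ PosOrth p (pos⊞ o₁) ] (pos⊞ o₂ ≈ pos⊞ o')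
  pos⊞-assoc {p} {q} {r} (b , bnd , pa₁ , pc₁ , pr₁) (b' , bnd' , pa₂ , pc₂ , pr₂) = o₁ , o₂ , sum
    where
    module S  = Splits (bound-splits bnd)
    module S' = Splits (bound-splits bnd')
    a₁ c₁ r₁ a₂ c₂ r₂ : X ⇒ X
    a₁ = part₁ b
    c₁ = part₂ b
    r₁ = rest b
    a₂ = part₁ b'
    c₂ = part₂ b'
    r₂ = rest b'
    a₂≈ : a₂ ≈ a₁ ⊹ c₁
    a₂≈ = ≈-trans (≈-sym S'.π₁p) (proj₁ bound⊞-components)
    r₁≈ : r₁ ≈ c₂ ⊹ r₂
    r₁≈ = ≈-trans (≈-sym (proj₂ bound⊞-components)) S'.π₂p
    o₁ : PosOrth q r
    o₁ = positive-bound c₁ c₂ (a₁ ⊹ r₂) pc₁ pc₂ (positive-⊹ pa₁ pr₂) (record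
      { π₁p = S.π₁q
      ; π₂p = ≈-trans S.π₂q (≈-trans (≈-refl ⟩⊹⟨ r₁≈) ⊹-swapˡ)
      ; π₁q = S'.π₁q
      ; π₂q = ≈-trans S'.π₂q (≈-trans (a₂≈ ⟩⊹⟨ ≈-refl) (≈-trans ⊹-assoc ⊹-swapˡ))
      })
    o₂ : PosOrth p (pos⊞ o₁)
    o₂ = positive-bound a₁ (c₁ ⊹ c₂) r₂ pa₁ (positive-⊹ pc₁ pc₂) pr₂ (record
      { π₁p = S.π₁p
      ; π₂p = ≈-trans S.π₂p (≈-trans (≈-refl ⟩⊹⟨ r₁≈) (≈-sym ⊹-assoc))
      ; π₁q = proj₁ triple-sum
      ; π₂q = proj₂ triple-sum
      })
    sum : pos⊞ o₂ ≈ bound⊞ ∘ b'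
    sum = components-unique
      (components-resp ≈-refl (≈-trans (≈-sym ⊹-assoc) (≈-sym a₂≈ ⟩⊹⟨ ≈-refl)) ≈-refl triple-sum)
      bound⊞-components

  pos-pred-effect-algebra : PosPredIsEffectAlgebra X
  pos-pred-effect-algebra = record
    { isEquivalence = equiv
    ; P-zero        = falsity-pospred
    ; P-orth        = ᗮ-pospred
    ; P-sum         = λ px _ → ⊞-pospred px
    ; O-resp        = λ _ _ _ _ → pos-orth-resp
    ; sum-cong      = λ _ _ _ _ → pos⊞-cong
    ; orth-cong     = λ _ _ → refl⟩∘⟨_
    ; comm          = λ _ _ → pos⊞-comm
    ; assoc         = λ _ _ _ → pos⊞-assoc
    ; unit          = pos⊞-unit
    ; orth-sum      = pos-ᗮ-orth
    ; orth-unique   = λ _ _ → pos-ᗮ-unique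
    ; zero-one      = λ _ → pos-orth-one-is-zero
    }

proposition5p6 : ∀ {o ℓ e : Level} →
    ((C : Category o ℓ e) (cp : BinaryCoproducts C) →
       CoproductAssumption C cp →
       (X : Category.Obj C) →
       PredIsEffectAlgebra C (BinaryCoproducts.raw cp) X)
    ×
    ((C : Category o ℓ e) (D : DaggerAdditive C) →
       DaggerAdditive.Zerosumfree D →
       (X : Category.Obj C) →
       DaggerAdditive.PosPredIsEffectAlgebra D X)
proposition5p6 =
  (λ C cp assumption X → PredicateEffectAlgebra.pred-effect-algebra C cp assumption X) ,
  (λ C D zerosumfree X → PositivePredicateEffectAlgebra.pos-pred-effect-algebra C D zerosumfree X)
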